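{- Let $\langle\mathbf{A}_{\mathrm d},\mathbf{A},\iota\rangle$ be a distributively generated (generalized) additive quantale with multiplication, let $\mathbf{Q}$ be an $\mathbf{A}$-module and $u\in Q$. Then $\mathbf{Q}$ is $u$-cyclic if and only if $u$ is a dividing element and $(x/_\ast u)\ast u=x$ for each $x\in Q$.
   Context: Fix one of two parallel settings: plain ("joins" = joins of arbitrary families) or generalized ("joins" = joins of non-empty families). A (generalized) quantale is $\langle Q,\bigvee,+,\mathsf{0}\rangle$ with $Q$ a poset having all such joins, $\langle Q,+,\mathsf{0}\rangle$ a monoid with $+$ order-preserving and distributing over such joins on both sides. A (generalized) additive quantale with multiplication is a triple $\langle\mathbf{A}_{\mathrm d},\mathbf{A},\iota\rangle$: $\mathbf{A}_{\mathrm d}$ a monoid, $\mathbf{A}$ a (generalized) quantale with an additional monoid structure $\langle A,\cdot,\mathsf 1\rangle$, $\iota$ a monoid homomorphism, such that $(\bigvee_i a_i)\cdot b=\bigvee_i(a_i\cdot b)$, $(a+b)\cdot c=a\cdot c+b\cdot c$, $\mathsf0\cdot a=\mathsf0$, and for $d\in\mathbf{A}_{\mathrm d}$ left multiplication by $\iota(d)$ preserves joins, $+$, $\mathsf0$; distributively generated means $\mathbf{A}$ is generated as a (generalized) quantale by $\iota[\mathbf{A}_{\mathrm d}]$. An $\mathbf{A}$-module is a (generalized) quantale $\mathbf{Q}$ with $\ast\colon A\times Q\to Q$, order-preserving in both coordinates, with $(a\cdot b)\ast x=a\ast(b\ast x)$, $\mathsf1\ast x=x$, $(a+b)\ast x=a\ast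 x+b\ast x$, $\mathsf0\ast x=\mathsf0$, $(\bigvee_i a_i)\ast x=\bigvee_i(a_i\ast x)$, and $x\mapsto\iota(d)\ast x$ preserving $+$, $\mathsf0$, joins for $d\in\mathbf{A}_{\mathrm d}$. $\mathbf{Q}$ is $u$-cyclic if $Q=\{a\ast u: a\in A\}$. $u$ is a dividing element if for each $y\in Q$ there is $a\in A$ with $a\ast u\leq y$; then $y/_\ast u:=\bigvee\{b\in A: b\ast u\leq y\}$. -}

module Defs where

open import Data.Unit using (⊤; tt)
open import Data.Product using (Σ; _×_; _,_; proj₁; proj₂; ∃)
open import Relation.Binary.PropositionalEquality using (_≡_)
open import Algebra.Structures using (IsMonoid)

-- The two parallel settings: plain (joins of arbitrary families) and
-- generalized (joins of non-empty families).
data Setting : Set where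
  plain generalized : Setting

-- Admissible index sets for joins: any index set in the plain setting,
-- an index set together with a witness of non-emptiness in the generalized one.
Adm : Setting → Set → Set
Adm plain       I = ⊤
Adm generalized I = I

admOf : (s : Setting) {I : Set} → I → Adm s I
admOf plain       i = tt
admOf generalized i = i

record Quantale (s : Setting) : Set₁ where
  infixl 6 _+_
  infix 4 _≤_
  field
    Carrier  : Set
    _≤_      : Carrier → Carrier → Set
    ≤-refl   : ∀ {x} → x ≤ x
    ≤-trans  : ∀ {x y z} → x ≤ y → y ≤ z → x ≤ z
    ≤-antisym : ∀ {x y} → x ≤ y → y ≤ x → x ≡ y
    ⋁        : {I : Set} → Adm s I → (I → Carrier) → Carrier
    ⋁-upper  : ∀ {I} (p : Adm s I) (f : I → Carrier) (i : I) → f i ≤ ⋁ p f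
    ⋁-least  : ∀ {I} (p : Adm s I) (f : I → Carrier) (x : Carrier) →
               (∀ i → f i ≤ x) → ⋁ p f ≤ x
    _+_      : Carrier → Carrier → Carrier
    𝟘        : Carrier
    +-isMonoid : IsMonoid _≡_ _+_ 𝟘
    +-mono   : ∀ {a a′ b b′} → a ≤ a′ → b ≤ b′ → a + b ≤ a′ + b′
    +-distribˡ-⋁ : ∀ {I} (p : Adm s I) (f : I → Carrier) (a : Carrier) →
                   a + ⋁ p f ≡ ⋁ p (λ i → a + f i)
    +-distribʳ-⋁ : ∀ {I} (p : Adm s I) (f : I → Carrier) (a : Carrier) →
                   ⋁ p f + a ≡ ⋁ p (λ i → f i + a)

record AQM (s : Setting) : Set₁ where
  field
    Ad        : Set
    _∙_       : Ad → Ad → Ad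
    ε         : Ad
    Ad-isMonoid : IsMonoid _≡_ _∙_ ε
    𝐀         : Quantale s
  open Quantale 𝐀
  infixl 7 _·_
  field
    _·_       : Carrier → Carrier → Carrier
    𝟙         : Carrier
    ·-isMonoid : IsMonoid _≡_ _·_ 𝟙
    ι         : Ad → Carrier
    ι-∙       : ∀ d e → ι (d ∙ e) ≡ ι d · ι e
    ι-ε       : ι ε ≡ 𝟙
    ⋁-·       : ∀ {I} (p : Adm s I) (f : I → Carrier) (b : Carrier) →
                ⋁ p f · b ≡ ⋁ p (λ i → f i · b)
    +-·       : ∀ a b c → (a + b) · c ≡ a · c + b · c
    𝟘-·       : ∀ a → 𝟘 · a ≡ 𝟘
    ι-·-⋁     : ∀ (d : Ad) {I} (p : Adm s I) (f : I → Carrier) →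
                ι d · ⋁ p f ≡ ⋁ p (λ i → ι d · f i)
    ι-·-+     : ∀ (d : Ad) a b → ι d · (a + b) ≡ ι d · a + ι d · b
    ι-·-𝟘     : ∀ (d : Ad) → ι d · 𝟘 ≡ 𝟘

data Generated {s : Setting} (A : AQM s) : Quantale.Carrier (AQM.𝐀 A) → Set₁ where
  gen-ι : ∀ d → Generated A (AQM.ι A d)
  gen-⋁ : ∀ {I} (p : Adm s I) (f : I → Quantale.Carrier (AQM.𝐀 A)) →
          (∀ i → Generated A (f i)) → Generated A (Quantale.⋁ (AQM.𝐀 A) p f)
  gen-+ : ∀ {a b} → Generated A a → Generated A b →
          Generated A (Quantale._+_ (AQM.𝐀 A) a b)
  gen-𝟘 : Generated A (Quantale.𝟘 (AQM.𝐀 A))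

DistributivelyGenerated : {s : Setting} → AQM s → Set₁
DistributivelyGenerated A = ∀ a → Generated A a

record Module {s : Setting} (A : AQM s) : Set₁ where
  private
    module A = Quantale (AQM.𝐀 A)
    module M = AQM A
  field
    𝐐   : Quantale s
  open Quantale 𝐐
  infixr 7 _*_
  field
    _*_      : A.Carrier → Carrier → Carrier
    *-mono   : ∀ {a a′ x x′} → a A.≤ a′ → x ≤ x′ → a * x ≤ a′ * x′
    ·-*      : ∀ a b x → (a M.· b) * x ≡ a * (b * x)
    𝟙-*      : ∀ x → M.𝟙 * x ≡ x
    +-*      : ∀ a b x → (a A.+ b) * x ≡ a * x + b * x
    𝟘-*      : ∀ x → A.𝟘 * x ≡ 𝟘
    ⋁-*      : ∀ {I} (p : Adm s I) (f : I → A.Carrier) (x : Carrier) →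
               A.⋁ p f * x ≡ ⋁ p (λ i → f i * x)
    ι-*-+    : ∀ (d : M.Ad) x y → M.ι d * (x + y) ≡ M.ι d * x + M.ι d * y
    ι-*-𝟘    : ∀ (d : M.Ad) → M.ι d * 𝟘 ≡ 𝟘
    ι-*-⋁    : ∀ (d : M.Ad) {I} (p : Adm s I) (f : I → Carrier) →
               M.ι d * ⋁ p f ≡ ⋁ p (λ i → M.ι d * f i)

module _ {s : Setting} {A : AQM s} (Q : Module A) where
  private
    module A = Quantale (AQM.𝐀 A)
    module Q = Quantale (Module.𝐐 Q)
  open Module Q using (_*_)

  Cyclic : Q.Carrier → Set
  Cyclic u = ∀ (y : Q.Carrier) → Σ A.Carrier λ a → a * u ≡ y

  Dividing : Q.Carrier → Set
  Dividing u = ∀ (y : Q.Carrier) → Σ A.Carrier λ a → a * u Q.≤ y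

  -- y /* u := ⋁ { b ∈ A ∣ b * u ≤ y }  (the family is non-empty since u is dividing).
  residual : (u : Q.Carrier) → Dividing u → Q.Carrier → A.Carrier
  residual u dv y =
    A.⋁ {Σ A.Carrier λ b → b * u Q.≤ y} (admOf s (dv y)) proj₁

-- Since * distributes over joins in its first argument, (y /* u) * u is the
-- largest element of the form b * u below y; hence it equals y exactly when
-- y is of the form a * u.
module Submission where

open import Defs
open import Data.Product using (Σ; _,_; proj₁; proj₂)
open import Relation.Binary.PropositionalEquality using (_≡_; refl; sym; subst)
open import Function.Bundles using (_⇔_; mk⇔)

module _ {s : Setting} {A : AQM s} (Q : Module A) (u : Quantale.Carrier (Module.𝐐 Q)) where
  private
    module 𝑨 = Quantale (AQM.𝐀 A)
    module 𝑸 = Quantale (Module.𝐐 Q)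
  open Module Q using (_*_; *-mono; ⋁-*)

  cyclic⇒dividing : Cyclic Q u → Dividing Q u
  cyclic⇒dividing cyclic y with cyclic y
  ... | a , refl = a , 𝑸.≤-refl

  module _ (dv : Dividing Q u) where

    ≤-residual : ∀ {b y} → b * u 𝑸.≤ y → b 𝑨.≤ residual Q u dv y
    ≤-residual {b} {y} bu≤y = 𝑨.⋁-upper _ proj₁ (b , bu≤y)

    residual-*-≤ : ∀ y → residual Q u dv y * u 𝑸.≤ y
    residual-*-≤ y = subst (𝑸._≤ y) (sym (⋁-* _ proj₁ u))
      (𝑸.⋁-least _ (λ i → proj₁ i * u) y proj₂)

    residual-*-inverse : ∀ {a y} → a * u ≡ y → residual Q u dv y * u ≡ y
    residual-*-inverse {a} refl = 𝑸.≤-antisym (residual-*-≤ (a * u))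
      (*-mono (≤-residual 𝑸.≤-refl) 𝑸.≤-refl)

  cyclic⇔residual-*-inverse :
    Cyclic Q u ⇔ Σ (Dividing Q u) (λ dv → ∀ x → residual Q u dv x * u ≡ x)
  cyclic⇔residual-*-inverse = mk⇔ to from
    where
    to : Cyclic Q u → Σ (Dividing Q u) (λ dv → ∀ x → residual Q u dv x * u ≡ x)
    to cyclic = dv , λ x → residual-*-inverse dv (proj₂ (cyclic x))
      where
      dv : Dividing Q u
      dv = cyclic⇒dividing cyclic
    from : Σ (Dividing Q u) (λ dv → ∀ x → residual Q u dv x * u ≡ x) → Cyclic Q u
    from (dv , inverse) y = residual Q u dv y , inverse y

lemma6p4 : (s : Setting) (A : AQM s) → DistributivelyGenerated A →
    (Q : Module A) (u : Quantale.Carrier (Module.𝐐 Q)) →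
    Cyclic Q u ⇔ Σ (Dividing Q u) (λ dv → ∀ x → Module._*_ Q (residual Q u dv x) u ≡ x)
lemma6p4 s A _ = cyclic⇔residual-*-inverse
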